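{- If $\mathfrak T$ is a linear ternary ring, then the quasigroups $\mathfrak T^\diamond$ and $\mathfrak T^\times$ are isotopic.
   Context: A ternary ring $\mathfrak T$ is a set with ternary operation $t$ and elements $0\ne1$ such that (T1) for $a\ne c$ there is a unique $x$ with $t(x,a,b)=t(x,c,d)$; (T2) for any $a,b,c$ a unique $x$ with $t(a,b,x)=c$; (T3) for $a\ne c$ a unique $(x,y)$ with $t(a,x,y)=b$, $t(c,x,y)=d$; (T4) $t(0,a,b)=t(a,0,b)=b$, $t(1,a,0)=t(a,1,0)=a$. Define $a+b:=t(1,a,b)$ and $a\times b:=t(a,b,0)$; $\mathfrak T^\times=(\mathfrak T\setminus\{0\},\times)$. For nonzero $x,y$, $x\diamond y$ is the nonzero $z$ with $t(x,y,z)=0$, and $\mathfrak T^\diamond=(\mathfrak T\setminus\{0\},\diamond)$. $\mathfrak T$ is linear if $t(a,b,c)=(a\times b)+c$ for all $a,b,c$. Quasigroups $(Q,\cdot),(Q',\times)$ are isotopic if there are bijections $\alpha,\beta,\gamma:Q\to Q'$ with $\alpha(x)\times\beta(y)=\gamma(x\cdot y)$ for all $x,y$. -}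

module Defs where

open import Level using (Level; _⊔_)
open import Data.Product using (Σ; _×_; _,_; proj₁; proj₂; ∃; ∃!)
open import Relation.Binary.PropositionalEquality using (_≡_; _≢_; refl; sym; trans; cong)
open import Relation.Nullary using (¬_)
open import Function.Bundles using (Bijection)
open import Relation.Binary.PropositionalEquality using (setoid)
open import Relation.Binary.Bundles using (Setoid)
import Relation.Binary.Construct.On as On

record TernaryRing {ℓ : Level} (T : Set ℓ) : Set ℓ where
  field
    t   : T → T → T → T
    𝟘   : T
    𝟙   : T
    0≢1 : 𝟘 ≢ 𝟙
    T1  : ∀ a b c d → a ≢ c → ∃! _≡_ (λ x → t x a b ≡ t x c d)
    T2  : ∀ a b c → ∃! _≡_ (λ x → t a b x ≡ c)
    T3  : ∀ a b c d → a ≢ c →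
          ∃! _≡_ (λ (p : T × T) → t a (proj₁ p) (proj₂ p) ≡ b × t c (proj₁ p) (proj₂ p) ≡ d)
    T4a : ∀ a b → t 𝟘 a b ≡ b
    T4b : ∀ a b → t a 𝟘 b ≡ b
    T4c : ∀ a → t 𝟙 a 𝟘 ≡ a
    T4d : ∀ a → t a 𝟙 𝟘 ≡ a

  _⊕_ : T → T → T
  a ⊕ b = t 𝟙 a b

  _⊗_ : T → T → T
  a ⊗ b = t a b 𝟘

  T* : Set ℓ
  T* = Σ T (λ x → x ≢ 𝟘)

  nonzero-mul : ∀ a b → a ≢ 𝟘 → b ≢ 𝟘 → t a b 𝟘 ≢ 𝟘
  nonzero-mul a b a≢0 b≢0 eq with T1 b 𝟘 𝟘 𝟘 b≢0
  ... | (x , px , uniq) =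
    a≢0 (trans (sym (uniq (trans eq (sym (T4b a 𝟘)))))
               (uniq (trans (T4a b 𝟘) (sym (T4a 𝟘 𝟘)))))

  _×*_ : T* → T* → T*
  (a , a≢0) ×* (b , b≢0) = t a b 𝟘 , nonzero-mul a b a≢0 b≢0

  diamond-nonzero : ∀ x y → x ≢ 𝟘 → y ≢ 𝟘 → proj₁ (T2 x y 𝟘) ≢ 𝟘
  diamond-nonzero x y x≢0 y≢0 z≡0 =
    nonzero-mul x y x≢0 y≢0
      (trans (cong (t x y) (sym z≡0)) (proj₁ (proj₂ (T2 x y 𝟘))))

  _⋄_ : T* → T* → T*
  (x , x≢0) ⋄ (y , y≢0) = proj₁ (T2 x y 𝟘) , diamond-nonzero x y x≢0 y≢0

  linear : Set ℓ
  linear = ∀ a b c → t a b c ≡ (a ⊗ b) ⊕ c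

record Isotopic {c ℓ : Level} (Q Q' : Setoid c ℓ)
                (_·_ : Setoid.Carrier Q → Setoid.Carrier Q → Setoid.Carrier Q)
                (_∘'_ : Setoid.Carrier Q' → Setoid.Carrier Q' → Setoid.Carrier Q')
                : Set (c ⊔ ℓ) where
  field
    α β γ : Bijection Q Q'
    iso   : ∀ x y → Setoid._≈_ Q' (Bijection.to α x ∘' Bijection.to β y) (Bijection.to γ (x · y))

-- The quasigroups 𝔗^⋄ and 𝔗^× are isotopic. Nonzero elements are pairs (x , x ≢ 0),
-- compared by their underlying element (so proofs of x ≢ 0 are irrelevant).
module _ {ℓ : Level} {T : Set ℓ} (𝔗 : TernaryRing T) where
  open TernaryRing 𝔗

  T*-setoid : Setoid ℓ ℓ
  T*-setoid = On.setoid {B = T*} (setoid T) proj₁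

  DiamondTimesIsotopic : Set ℓ
  DiamondTimesIsotopic = Isotopic T*-setoid T*-setoid _⋄_ _×*_

module Submission where

-- In a linear ternary ring t(x,y,z) = (x × y) + z, so the element
-- x ⋄ y, defined by t(x,y,x ⋄ y) = 0, is exactly the element z with
-- (x × y) + z = 0.  Hence x × y = ν(x ⋄ y), where ν(z) is the "left negative"
-- of z: the unique w with w + z = 0 (it exists and is unique by (T3) applied
-- to the rows 1 and 0).  The map ν has the inverse w ↦ "the unique z with
-- w + z = 0" given by (T2), and both maps preserve being nonzero, so ν is a
-- permutation of the nonzero elements.  Therefore id, id, ν is an isotopy
-- from 𝔗^⋄ to 𝔗^×.

open import Defs
open import Level using (Level)
open import Data.Product using (_,_; proj₁; proj₂)
open import Relation.Binary.PropositionalEquality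
open import Function.Bundles using (Bijection; Inverse)
open import Function.Properties.Inverse using (Inverse⇒Bijection)
import Function.Construct.Identity as Identity

module Negation {ℓ : Level} {T : Set ℓ} (𝔗 : TernaryRing T) where
  open TernaryRing 𝔗

  1≢0 : 𝟙 ≢ 𝟘
  1≢0 1≡0 = 0≢1 (sym 1≡0)

  sum-zero-leftzero : ∀ {w z} → w ⊕ z ≡ 𝟘 → w ≡ 𝟘 → z ≡ 𝟘
  sum-zero-leftzero {w} {z} w+z≡0 w≡0 = begin
    z          ≡⟨ sym (T4b 𝟙 z) ⟩
    𝟘 ⊕ z      ≡⟨ cong (_⊕ z) (sym w≡0) ⟩
    w ⊕ z      ≡⟨ w+z≡0 ⟩
    𝟘          ∎
    where open ≡-Reasoning

  sum-zero-rightzero : ∀ {w z} → w ⊕ z ≡ 𝟘 → z ≡ 𝟘 → w ≡ 𝟘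
  sum-zero-rightzero {w} {z} w+z≡0 z≡0 = begin
    w          ≡⟨ sym (T4c w) ⟩
    w ⊕ 𝟘      ≡⟨ cong (w ⊕_) (sym z≡0) ⟩
    w ⊕ z      ≡⟨ w+z≡0 ⟩
    𝟘          ∎
    where open ≡-Reasoning

  negʳ : T → T
  negʳ w = proj₁ (T2 𝟙 w 𝟘)

  negʳ-spec : ∀ w → w ⊕ negʳ w ≡ 𝟘
  negʳ-spec w = proj₁ (proj₂ (T2 𝟙 w 𝟘))

  negʳ-unique : ∀ {w z} → w ⊕ z ≡ 𝟘 → negʳ w ≡ z
  negʳ-unique {w} = proj₂ (proj₂ (T2 𝟙 w 𝟘))

  -- Left negative: (T3) for the rows 1 ≠ 0 gives a unique pair (w , v) with
  -- t(1,w,v) = 0 and t(0,w,v) = z; since t(0,w,v) = v this says v = z and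
  -- w + z = 0.
  negˡ : T → T
  negˡ z = proj₁ (proj₁ (T3 𝟙 𝟘 𝟘 z 1≢0))

  negˡ-spec : ∀ z → negˡ z ⊕ z ≡ 𝟘
  negˡ-spec z with T3 𝟙 𝟘 𝟘 z 1≢0
  ... | (w , v) , (t1wv≡0 , t0wv≡z) , _ =
    subst (λ u → t 𝟙 w u ≡ 𝟘) (trans (sym (T4a w v)) t0wv≡z) t1wv≡0

  negˡ-unique : ∀ {w z} → w ⊕ z ≡ 𝟘 → negˡ z ≡ w
  negˡ-unique {w} {z} w+z≡0 =
    cong proj₁ (proj₂ (proj₂ (T3 𝟙 𝟘 𝟘 z 1≢0)) (w+z≡0 , T4a w z))

  negˡ-negʳ : ∀ w → negˡ (negʳ w) ≡ w
  negˡ-negʳ w = negˡ-unique (negʳ-spec w)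

  negʳ-negˡ : ∀ z → negʳ (negˡ z) ≡ z
  negʳ-negˡ z = negʳ-unique (negˡ-spec z)

  negˡ-nonzero : ∀ {z} → z ≢ 𝟘 → negˡ z ≢ 𝟘
  negˡ-nonzero z≢0 ν≡0 = z≢0 (sum-zero-leftzero (negˡ-spec _) ν≡0)

  negʳ-nonzero : ∀ {w} → w ≢ 𝟘 → negʳ w ≢ 𝟘
  negʳ-nonzero w≢0 ν≡0 = w≢0 (sum-zero-rightzero (negʳ-spec _) ν≡0)

  negˡ-inverse : Inverse (T*-setoid 𝔗) (T*-setoid 𝔗)
  negˡ-inverse = record
    { to        = λ (z , z≢0) → negˡ z , negˡ-nonzero z≢0
    ; from      = λ (w , w≢0) → negʳ w , negʳ-nonzero w≢0
    ; to-cong   = cong negˡ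
    ; from-cong = cong negʳ
    ; inverse   = (λ {w} z≡νw → trans (cong negˡ z≡νw) (negˡ-negʳ (proj₁ w)))
                , (λ {z} w≡νz → trans (cong negʳ w≡νz) (negʳ-negˡ (proj₁ z)))
    }

  negˡ-bijection : Bijection (T*-setoid 𝔗) (T*-setoid 𝔗)
  negˡ-bijection = Inverse⇒Bijection negˡ-inverse

  -- Under linearity, x ⋄ y is the right negative of x × y, so its left
  -- negative is x × y.
  negˡ-diamond : linear → ∀ x y → negˡ (proj₁ (x ⋄ y)) ≡ proj₁ (x ×* y)
  negˡ-diamond lin (x , _) (y , _) =
    negˡ-unique (trans (sym (lin x y (proj₁ (T2 x y 𝟘)))) (proj₁ (proj₂ (T2 x y 𝟘))))

proposition2p1 : {ℓ : Level} {T : Set ℓ} (𝔗 : TernaryRing T) →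
                 TernaryRing.linear 𝔗 →
                 DiamondTimesIsotopic 𝔗
proposition2p1 𝔗 lin = record
  { α   = Identity.bijection (T*-setoid 𝔗)
  ; β   = Identity.bijection (T*-setoid 𝔗)
  ; γ   = negˡ-bijection
  ; iso = λ x y → sym (negˡ-diamond lin x y)
  }
  where open Negation 𝔗
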